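{- Let $\mathcal{A}$ be a finite set, let $q \geq 2$ be an integer, and let $(U(n))_{n \geq 0}$ be a sequence with values in $\mathcal{A}$. Put $N = \frac{q^{t+1}-1}{q-1}$. Suppose that there exist four nonnegative integers $t, a, b, n_0$ and $q^{t+1}$ functions $f_0, f_1, \ldots, f_{q^{t+1}-1} : \mathcal{A}^{a+b+N} \to \mathcal{A}$ such that for all $j \in [0, q^{t+1}-1]$ and all $n \geq n_0$, $$U(q^{t+1}n+j) = f_j\big(U^{ -a}(n), \ldots, U^{ -1}(n), U^0(n), U^{1}(n), \ldots, U^b(n), U_2(n), U_3(n), \ldots, U_{N}(n)\big),$$ where $U_1 = U, U_2, \ldots, U_N$ are the $N$ subsequences $(U(q^i n + j'))_{n \geq 0}$ with $i \in [0,t]$ and $j' \in [0, q^i-1]$, listed in some fixed order (with $U_1 = U$). Then the sequence $(U(n))_{n \geq 0}$ is $q$-automatic.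
   Context: For a sequence $W = (W(n))_{n\ge 0}$ and an integer $\alpha \in \mathbb{Z}$, $W^{\alpha}$ denotes the sequence defined for $n \geq -\alpha$ by $W^{\alpha}(n) := W(n+\alpha)$. Convention: if a sequence is only defined for $n \geq c$ (for some integer $c \ge 0$), its values for $n \in [0,c)$ are taken to be arbitrary. A sequence $(U(n))_{n\ge 0}$ with values in a finite set is $q$-automatic if there is a deterministic finite automaton with output that, on reading the base-$q$ representation of $n$, outputs $U(n)$; equivalently, its $q$-kernel $\{(U(q^e n + r))_{n \geq 0} : e \geq 0,\ 0 \leq r < q^e\}$ is finite. -}

module Defs where

open import Data.Nat using (ℕ; zero; suc; _+_; _*_; _∸_; _^_; _≤_; _<_)
open import Data.Fin using (Fin; toℕ)
open import Data.Vec using (Vec; tabulate; _++_; [])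
open import Data.Product using (Σ; ∃; _×_)
open import Relation.Binary.PropositionalEquality using (_≡_)

-- Deterministic finite automata with output (DFAO), reading base-q
-- representations most-significant digit first, canonical representation
-- (no leading zeros; 0 is represented by the empty word).

data Reads {s : ℕ} (q : ℕ) (δ : Fin s → Fin q → Fin s) (s₀ : Fin s)
     : ℕ → Fin s → Set where
  start : Reads q δ s₀ 0 s₀
  step  : ∀ {n st} (d : Fin q) → 0 < q * n + toℕ d →
          Reads q δ s₀ n st → Reads q δ s₀ (q * n + toℕ d) (δ st d)

Automatic : {A : Set} (q : ℕ) → (ℕ → A) → Set
Automatic {A} q U =
  Σ ℕ λ s → Σ (Fin s → Fin q → Fin s) λ δ → Σ (Fin s) λ s₀ → Σ (Fin s → A) λ τ →
    (n : ℕ) → Σ (Fin s) λ st → Reads q δ s₀ n st × τ st ≡ U n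

-- The subsequences U_2, …, U_N : (U(q^i n + j'))_n with 1 ≤ i ≤ t, 0 ≤ j' < q^i,
-- listed in the fixed order: by increasing i, then increasing j'.

-- S q t = q + q^2 + … + q^t, so N = 1 + S q t = (q^{t+1}-1)/(q-1).
S : ℕ → ℕ → ℕ
S q zero    = 0
S q (suc t) = S q t + q ^ suc t

N : ℕ → ℕ → ℕ
N q t = suc (S q t)

subseqs : {A : Set} (q : ℕ) (U : ℕ → A) (t : ℕ) (n : ℕ) → Vec A (S q t)
subseqs q U zero    n = []
subseqs q U (suc t) n =
  subseqs q U t n ++ tabulate (λ (j : Fin (q ^ suc t)) → U (q ^ suc t * n + toℕ j))

-- The argument vector
--   (U^{-a}(n), …, U^{-1}(n), U^0(n), …, U^b(n), U_2(n), …, U_N(n))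
-- of length a + (b + 1) + (N - 1) = a + b + N.
-- W k (for k : Fin a) is the sequence U^{-(a - k)}, whose values at the
-- positions where it is undefined are arbitrary.
args : {A : Set} (q : ℕ) (U : ℕ → A) (t a b : ℕ) (W : Fin a → ℕ → A) (n : ℕ) →
       Vec A (a + (suc b + S q t))
args q U t a b W n =
  tabulate (λ k → W k n) ++
  (tabulate (λ (k : Fin (suc b)) → U (n + toℕ k)) ++ subseqs q U t n)

module Submission where

open import Defs
open import Data.Nat using (ℕ; suc; _+_; _*_; _∸_; _^_; _≤_)
open import Data.Fin using (Fin; toℕ)
open import Data.Vec using (Vec)
open import Function.Bundles using (_↔_)
open import Relation.Binary.PropositionalEquality using (_≡_)

open import Data.Nat using (zero; _<_; s≤s; z≤n; NonZero; >-nonZero; _<?_)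
open import Data.Nat.Properties
open import Data.Nat.DivMod using (_/_; _mod_; _divMod_; m/n<m; m<n*o⇒m/o<n; /-monoˡ-≤; m*n/n≡m; module DivMod)
open import Data.Nat.Induction using (<-rec)
open import Data.Nat.Tactic.RingSolver using (solve-∀)
open import Data.Fin using (fromℕ<)
open import Data.Fin.Properties using (+↔⊎; toℕ-fromℕ<; toℕ<n)
open import Data.Vec using ([]; _∷_; _++_; tabulate; replicate)
open import Data.Vec.Properties using (tabulate-cong)
open import Data.Vec.Recursive using (lift↔; Fin[m^n]↔Fin[m]^n)
open import Data.Vec.Recursive.Properties using (↔Vec)
open import Data.Sum using (_⊎_; inj₁; inj₂)
open import Data.Sum.Function.Propositional using (_⊎-↔_)
open import Data.Product using (Σ; _×_; _,_)
open import Function.Bundles using (Inverse)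
open import Function.Properties.Inverse using (↔-sym; ↔-trans; ↔-refl)
open import Relation.Nullary using (yes; no)
open import Relation.Nullary.Negation using (contradiction)
open import Relation.Binary.PropositionalEquality using (refl; sym; trans; cong; cong₂; subst; module ≡-Reasoning)

-- Write q = r + 2, Q = q^{t+1}, c = a·q and m = n ∸ c.  For n ≥ c
-- the window state at n records, for every level i ≤ t, the block of values
--   U(q^i·m + β),   β < q^i·L,   where L = c + 2b + 1.
-- Reading a further digit d turns n into q·n + d and m into q·m + (q-1)·c + d,
-- so level i of the new window is a piece of level i+1 of the old one (i < t),
-- while the new top level consists of values U(Q·(m+s) + j) with a ≤ s and
-- s + b < L; by the hypothesis on U these are f_j applied to an argument vector
-- that lies inside the old window.  Hence, from n₁ = c + n₀ on, the window at
-- q·n + d is a function of the window at n and of d, and U(n) is read off the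
-- window.  Windows range over a finite set, so a finite automaton can run on
-- them (with the finitely many n < n₁ handled as extra states).

Finite : Set → Set
Finite B = Σ ℕ λ s → B ↔ Fin s

finite-⊎ : {B C : Set} → Finite B → Finite C → Finite (B ⊎ C)
finite-⊎ (m , B↔) (n , C↔) = m + n , ↔-trans (B↔ ⊎-↔ C↔) (↔-sym +↔⊎)

finite-Vec : {B : Set} → Finite B → (n : ℕ) → Finite (Vec B n)
finite-Vec (k , B↔) n =
  k ^ n , ↔-trans (↔-sym (↔Vec n)) (↔-trans (lift↔ n B↔) (↔-sym (Fin[m^n]↔Fin[m]^n k n)))

base-nonZero : ∀ {q} → 2 ≤ q → NonZero q
base-nonZero 2≤q = >-nonZero (≤-trans (s≤s z≤n) 2≤q)

reads-total : (q : ℕ) → 2 ≤ q → {s : ℕ} (δ : Fin s → Fin q → Fin s) (s₀ : Fin s) →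
              (n : ℕ) → Σ (Fin s) (Reads q δ s₀ n)
reads-total q 2≤q δ s₀ = <-rec _ reads
  where
  instance
    q≢0 : NonZero q
    q≢0 = base-nonZero 2≤q

  reads : ∀ n → (∀ {m} → m < n → Σ _ (Reads q δ s₀ m)) → Σ _ (Reads q δ s₀ n)
  reads zero    _   = s₀ , start
  reads (suc m) rec with rec (m/n<m (suc m) q 2≤q)
  ... | st , run = subst (λ k → Σ _ (Reads q δ s₀ k)) (sym expand)
                     (δ st d , step d (subst (0 <_) expand (s≤s z≤n)) run)
    where
    open DivMod (suc m divMod q) renaming (quotient to k; remainder to d)
    expand : suc m ≡ q * k + toℕ d
    expand = trans property (trans (+-comm (toℕ d) (k * q)) (cong (_+ toℕ d) (*-comm k q)))

automatic-by-states : {A D : Set} (q : ℕ) → 2 ≤ q → (U : ℕ → A) → Finite D →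
                      (δ : D → Fin q → D) (state : ℕ → D) (τ : D → A) →
                      (∀ n d → δ (state n) d ≡ state (q * n + toℕ d)) →
                      (∀ n → τ (state n) ≡ U n) → Automatic q U
automatic-by-states {A} q 2≤q U (s , D↔) δ state τ step-ok out-ok =
  s , δ′ , to (state 0) , output , λ n → run n (reads-total q 2≤q δ′ (to (state 0)) n)
  where
  open Inverse D↔ using (to; from; strictlyInverseʳ)

  δ′ : Fin s → Fin q → Fin s
  δ′ x d = to (δ (from x) d)

  output : Fin s → A
  output x = τ (from x)

  invariant : ∀ {n x} → Reads q δ′ (to (state 0)) n x → x ≡ to (state n)
  invariant start = refl
  invariant (step {n} d _ r) rewrite invariant r | strictlyInverseʳ (state n) =
    cong to (step-ok n d)

  run : ∀ n → Σ (Fin s) (Reads q δ′ (to (state 0)) n) →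
        Σ (Fin s) λ x → Reads q δ′ (to (state 0)) n x × output x ≡ U n
  run n (x , r) = x , r , (begin
    τ (from x)              ≡⟨ cong (λ y → τ (from y)) (invariant r) ⟩
    τ (from (to (state n))) ≡⟨ cong τ (strictlyInverseʳ (state n)) ⟩
    τ (state n)             ≡⟨ out-ok n ⟩
    U n                     ∎)
    where open ≡-Reasoning

-- It suffices that the recursion holds from some n₁ on: the finitely many
-- earlier n become states of their own.
automatic-by-eventual-states : {A D : Set} (q : ℕ) → 2 ≤ q → (U : ℕ → A) → Finite D →
                               (δ : D → Fin q → D) (state : ℕ → D) (τ : D → A) (n₁ : ℕ) →
                               (∀ n d → n₁ ≤ n → δ (state n) d ≡ state (q * n + toℕ d)) →
                               (∀ n → n₁ ≤ n → τ (state n) ≡ U n) → Automatic q U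
automatic-by-eventual-states {A} {D} q 2≤q U D-finite δ state τ n₁ step-ok out-ok =
  automatic-by-states q 2≤q U (finite-⊎ (n₁ , ↔-refl) D-finite) δ′ state′ τ′ step-ok′ out-ok′
  where
  instance
    q≢0 : NonZero q
    q≢0 = base-nonZero 2≤q

  state′ : ℕ → Fin n₁ ⊎ D
  state′ n with n <? n₁
  ... | yes n<n₁ = inj₁ (fromℕ< n<n₁)
  ... | no  _    = inj₂ (state n)

  state′-late : ∀ {n} → n₁ ≤ n → state′ n ≡ inj₂ (state n)
  state′-late {n} n₁≤n with n <? n₁
  ... | yes n<n₁ = contradiction n₁≤n (<⇒≱ n<n₁)
  ... | no  _    = refl

  δ′ : Fin n₁ ⊎ D → Fin q → Fin n₁ ⊎ D
  δ′ (inj₁ i) d = state′ (q * toℕ i + toℕ d)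
  δ′ (inj₂ x) d = inj₂ (δ x d)

  τ′ : Fin n₁ ⊎ D → A
  τ′ (inj₁ i) = U (toℕ i)
  τ′ (inj₂ x) = τ x

  step-ok′ : ∀ n d → δ′ (state′ n) d ≡ state′ (q * n + toℕ d)
  step-ok′ n d with n <? n₁
  ... | yes n<n₁ = cong (λ k → state′ (q * k + toℕ d)) (toℕ-fromℕ< n<n₁)
  ... | no  n≮n₁ = trans (cong inj₂ (step-ok n d n₁≤n)) (sym (state′-late n₁≤qn+d))
    where
    n₁≤n : n₁ ≤ n
    n₁≤n = ≮⇒≥ n≮n₁
    n₁≤qn+d : n₁ ≤ q * n + toℕ d
    n₁≤qn+d = ≤-trans n₁≤n (≤-trans (m≤n*m n q) (m≤m+n (q * n) (toℕ d)))

  out-ok′ : ∀ n → τ′ (state′ n) ≡ U n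
  out-ok′ n with n <? n₁
  ... | yes n<n₁ = cong U (toℕ-fromℕ< n<n₁)
  ... | no  n≮n₁ = out-ok n (≮⇒≥ n≮n₁)

-- Tabulation over ℕ-indices and lookup with a default outside the range; they let
-- the entries of a window be addressed by arithmetic expressions.
tabulateℕ : {B : Set} → (ℕ → B) → (n : ℕ) → Vec B n
tabulateℕ h zero    = []
tabulateℕ h (suc n) = h 0 ∷ tabulateℕ (λ m → h (suc m)) n

lookupℕ : {B : Set} {n : ℕ} → B → Vec B n → ℕ → B
lookupℕ z []      _       = z
lookupℕ z (x ∷ _) zero    = x
lookupℕ z (_ ∷ v) (suc m) = lookupℕ z v m

lookupℕ-tabulateℕ : {B : Set} (z : B) (h : ℕ → B) {n m : ℕ} → m < n →
                    lookupℕ z (tabulateℕ h n) m ≡ h m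
lookupℕ-tabulateℕ z h {suc n} {zero}  _         = refl
lookupℕ-tabulateℕ z h {suc n} {suc m} (s≤s m<n) = lookupℕ-tabulateℕ z (λ k → h (suc k)) m<n

tabulateℕ-cong : {B : Set} {h h′ : ℕ → B} (n : ℕ) → (∀ m → m < n → h m ≡ h′ m) →
                 tabulateℕ h n ≡ tabulateℕ h′ n
tabulateℕ-cong zero    _  = refl
tabulateℕ-cong (suc n) eq = cong₂ _∷_ (eq 0 (s≤s z≤n)) (tabulateℕ-cong n λ m m<n → eq (suc m) (s≤s m<n))

scaled-bound : ∀ x D {β M} → β < x * M → x * D + β < x * (D + M)
scaled-bound x D {β} {M} β<xM = ≤-trans (+-monoʳ-< (x * D) β<xM) (≤-reflexive (sym (*-distribˡ-+ x D M)))

digit-bound : ∀ x s {j M} → j < x → s < M → x * s + j < x * M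
digit-bound x s {j} {M} j<x s<M = ≤-trans (+-monoʳ-< (x * s) j<x)
  (≤-trans (≤-reflexive (trans (+-comm (x * s) x) (sym (*-suc x s)))) (*-monoʳ-≤ x s<M))

shift-identity : ∀ p m c d → (1 + p) * (m + c) + d ≡ ((1 + p) * m + (p * c + d)) + c
shift-identity = solve-∀

level-identity : ∀ q x m D β → x * (q * m + D) + β ≡ q * x * m + (x * D + β)
level-identity = solve-∀

rescale-identity : ∀ q x y → x * (q * y) ≡ q * x * y
rescale-identity = solve-∀

width-identity : ∀ r c b → (2 + r) * (1 + c + b) ≡ ((1 + r) * c + (1 + r) + (c + (1 + (b + b)))) + r * b
width-identity = solve-∀

swap-identity : ∀ q x y → x * (q * y) ≡ y * (q * x)
swap-identity = solve-∀

block-identity : ∀ x m s j → x * m + (j + s * x) ≡ x * (m + s) + j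
block-identity = solve-∀

digits-identity : ∀ x m s j → x * m + (x * s + j) ≡ x * (m + s) + j
digits-identity = solve-∀

module WindowConstruction
  {A : Set} (r : ℕ) (U : ℕ → A) (t a b n₀ : ℕ)
  (f : Fin (suc (suc r) ^ suc t) → Vec A (a + (suc b + S (suc (suc r)) t)) → A)
  (W : Fin a → ℕ → A)
  (W-shift : ∀ (i : Fin a) (n : ℕ) → a ∸ toℕ i ≤ n → W i n ≡ U (n ∸ (a ∸ toℕ i)))
  (U-rec : ∀ (j : Fin (suc (suc r) ^ suc t)) (n : ℕ) → n₀ ≤ n →
           U (suc (suc r) ^ suc t * n + toℕ j) ≡ f j (args (suc (suc r)) U t a b W n))
  where

  q : ℕ
  q = suc (suc r)

  Q : ℕ
  Q = q ^ suc t

  instance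
    Q≢0 : NonZero Q
    Q≢0 = m^n≢0 q (suc t)

  -- the window at n starts at position n ∸ c
  c : ℕ
  c = a * q

  L : ℕ
  L = c + suc (b + b)

  width : ℕ → ℕ
  width i = q ^ i * L

  width-mono : ∀ {i} → i ≤ t → width i ≤ width t
  width-mono i≤t = *-monoˡ-≤ L (^-monoʳ-≤ q i≤t)

  -- A window: levels 0 … t, each stored in a vector of the largest width.
  Grid : Set
  Grid = Vec (Vec A (width t)) (suc t)

  cell : Grid → ℕ → ℕ → A
  cell x i β = lookupℕ (U 0) (lookupℕ (replicate (width t) (U 0)) x i) β

  -- Entries beyond the width of their level are normalised to U 0, so that a grid
  -- is determined by its meaningful entries.
  clip : (ℕ → ℕ → A) → ℕ → ℕ → A
  clip g i β with β <? width i
  ... | yes _ = g i β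
  ... | no  _ = U 0

  frame : (ℕ → ℕ → A) → Grid
  frame g = tabulateℕ (λ i → tabulateℕ (clip g i) (width t)) (suc t)

  cell-frame : ∀ g {i β} → i ≤ t → β < width i → cell (frame g) i β ≡ g i β
  cell-frame g {i} {β} i≤t β<w
    rewrite lookupℕ-tabulateℕ (replicate (width t) (U 0)) (λ k → tabulateℕ (clip g k) (width t)) (s≤s i≤t)
          | lookupℕ-tabulateℕ (U 0) (clip g i) (≤-trans β<w (width-mono i≤t))
    with β <? width i
  ... | yes _    = refl
  ... | no  β≮w = contradiction β<w β≮w

  frame-cong : ∀ g h → (∀ i β → i ≤ t → β < width i → g i β ≡ h i β) → frame g ≡ frame h
  frame-cong g h eq = tabulateℕ-cong (suc t) λ i i<1+t → tabulateℕ-cong (width t) λ β _ → clip-cong i β (≤-pred i<1+t)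
    where
    clip-cong : ∀ i β → i ≤ t → clip g i β ≡ clip h i β
    clip-cong i β i≤t with β <? width i
    ... | yes β<w = eq i β i≤t β<w
    ... | no  _   = refl

  window : ℕ → Grid
  window n = frame λ i β → U (q ^ i * (n ∸ c) + β)

  -- The argument vector of f at position s, read off a window: the counterpart of
  -- `args` with U(k) replaced by the level-0 entry k and U(q^i·s + j) by the
  -- level-i entry q^i·s + j.
  levelsOf : Grid → ℕ → (i : ℕ) → Vec A (S q i)
  levelsOf x s zero    = []
  levelsOf x s (suc i) =
    levelsOf x s i ++ tabulate λ (j : Fin (q ^ suc i)) → cell x (suc i) (q ^ suc i * s + toℕ j)

  argsOf : Grid → ℕ → Vec A (a + (suc b + S q t))
  argsOf x s =
    tabulate (λ k → cell x 0 (s ∸ (a ∸ toℕ k))) ++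
    (tabulate (λ (k : Fin (suc b)) → cell x 0 (s + toℕ k)) ++ levelsOf x s t)

  cell-window₀ : ∀ n {β} → β < L → cell (window n) 0 β ≡ U (n ∸ c + β)
  cell-window₀ n {β} β<L =
    trans (cell-frame _ z≤n (subst (β <_) (sym (*-identityˡ L)) β<L))
          (cong (λ k → U (k + β)) (*-identityˡ (n ∸ c)))

  args-window : ∀ n s → a ≤ s → s + b < L → argsOf (window n) s ≡ args q U t a b W (n ∸ c + s)
  args-window n s a≤s s+b<L =
    cong₂ _++_ (tabulate-cong past) (cong₂ _++_ (tabulate-cong future) (levels t ≤-refl))
    where
    m : ℕ
    m = n ∸ c

    s<L : s < L
    s<L = ≤-<-trans (m≤m+n s b) s+b<L

    past : ∀ k → cell (window n) 0 (s ∸ (a ∸ toℕ k)) ≡ W k (m + s)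
    past k = begin
      cell (window n) 0 (s ∸ (a ∸ toℕ k)) ≡⟨ cell-window₀ n (≤-<-trans (m∸n≤m s (a ∸ toℕ k)) s<L) ⟩
      U (m + (s ∸ (a ∸ toℕ k)))           ≡⟨ cong U (sym (+-∸-assoc m a∸k≤s)) ⟩
      U (m + s ∸ (a ∸ toℕ k))             ≡⟨ sym (W-shift k (m + s) (≤-trans a∸k≤s (m≤n+m s m))) ⟩
      W k (m + s)                         ∎
      where
      open ≡-Reasoning
      a∸k≤s : a ∸ toℕ k ≤ s
      a∸k≤s = ≤-trans (m∸n≤m a (toℕ k)) a≤s

    future : ∀ (k : Fin (suc b)) → cell (window n) 0 (s + toℕ k) ≡ U (m + s + toℕ k)
    future k = trans (cell-window₀ n (≤-<-trans (+-monoʳ-≤ s (≤-pred (toℕ<n k))) s+b<L))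
                     (cong U (sym (+-assoc m s (toℕ k))))

    levels : ∀ i → i ≤ t → levelsOf (window n) s i ≡ subseqs q U i (m + s)
    levels zero    _     = refl
    levels (suc i) 1+i≤t = cong₂ _++_ (levels i (≤-trans (n≤1+n i) 1+i≤t)) (tabulate-cong block)
      where
      block : ∀ (j : Fin (q ^ suc i)) →
              cell (window n) (suc i) (q ^ suc i * s + toℕ j) ≡ U (q ^ suc i * (m + s) + toℕ j)
      block j = trans (cell-frame _ 1+i≤t (digit-bound (q ^ suc i) s (toℕ<n j) s<L))
                      (cong U (digits-identity (q ^ suc i) m s (toℕ j)))

  shift : Fin q → ℕ
  shift d = suc r * c + toℕ d

  shift-step : ∀ {n} d → c ≤ n → (q * n + toℕ d) ∸ c ≡ q * (n ∸ c) + shift d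
  shift-step {n} d c≤n = begin
    (q * n + toℕ d) ∸ c             ≡⟨ cong (λ k → (q * k + toℕ d) ∸ c) (sym (m∸n+n≡m c≤n)) ⟩
    (q * (n ∸ c + c) + toℕ d) ∸ c   ≡⟨ cong (_∸ c) (shift-identity (suc r) (n ∸ c) c (toℕ d)) ⟩
    (q * (n ∸ c) + shift d) + c ∸ c ≡⟨ m+n∸n≡m _ c ⟩
    q * (n ∸ c) + shift d           ∎
    where open ≡-Reasoning

  L-unfold : L ≡ suc (c + b + b)
  L-unfold = trans (+-suc c (b + b)) (cong suc (sym (+-assoc c b b)))

  shift-bound : ∀ d → shift d + L ≤ q * suc (c + b)
  shift-bound d = ≤-trans (+-monoˡ-≤ L (+-monoʳ-≤ (suc r * c) (≤-pred (toℕ<n d))))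
    (≤-trans (m≤m+n _ (r * b)) (≤-reflexive (sym (width-identity r c b))))

  -- Level i of the new window is a part of level i + 1 of the old one.
  level-bound : ∀ {i β} d → β < width i → q ^ i * shift d + β < width (suc i)
  level-bound {i} d β<w = ≤-trans (scaled-bound (q ^ i) (shift d) β<w)
    (≤-trans (*-monoʳ-≤ (q ^ i) shift+L≤qL) (≤-reflexive (rescale-identity q (q ^ i) L)))
    where
    shift+L≤qL : shift d + L ≤ q * L
    shift+L≤qL = ≤-trans (shift-bound d)
      (*-monoʳ-≤ q (≤-trans (s≤s (m≤m+n (c + b) b)) (≤-reflexive (sym L-unfold))))

  -- The new top-level entry β sits at offset γ d β in the blocks of length Q
  -- following Q·m; it is entry γ mod Q of block number m + γ / Q.
  γ : Fin q → ℕ → ℕ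
  γ d β = q ^ t * shift d + β

  top-index : ∀ m d β → q ^ t * (q * m + shift d) + β ≡ Q * (m + γ d β / Q) + toℕ (γ d β mod Q)
  top-index m d β = begin
    q ^ t * (q * m + shift d) + β                    ≡⟨ level-identity q (q ^ t) m (shift d) β ⟩
    Q * m + γ d β                                    ≡⟨ cong (Q * m +_) (DivMod.property (γ d β divMod Q)) ⟩
    Q * m + (toℕ (γ d β mod Q) + γ d β / Q * Q)      ≡⟨ block-identity Q m (γ d β / Q) _ ⟩
    Q * (m + γ d β / Q) + toℕ (γ d β mod Q)          ∎
    where open ≡-Reasoning

  -- The block number satisfies a ≤ γ / Q and γ / Q + b < L, as `args-window` requires.
  top-lower : ∀ d β → a ≤ γ d β / Q
  top-lower d β = subst (_≤ γ d β / Q) (m*n/n≡m a Q) (/-monoˡ-≤ Q aQ≤γ)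
    where
    c≤shift : c ≤ shift d
    c≤shift = ≤-trans (m≤n*m c (suc r)) (m≤m+n (suc r * c) (toℕ d))
    aQ≤γ : a * Q ≤ γ d β
    aQ≤γ = ≤-trans (≤-reflexive (trans (swap-identity q a (q ^ t)) (cong (q ^ t *_) (*-comm q a))))
      (≤-trans (*-monoʳ-≤ (q ^ t) c≤shift) (m≤m+n (q ^ t * shift d) β))

  top-upper : ∀ d {β} → β < width t → γ d β / Q + b < L
  top-upper d {β} β<w = ≤-trans (+-monoˡ-< b (m<n*o⇒m/o<n γ<) ) (≤-reflexive (sym L-unfold))
    where
    γ< : γ d β < suc (c + b) * Q
    γ< = ≤-trans (scaled-bound (q ^ t) (shift d) β<w)
      (≤-trans (*-monoʳ-≤ (q ^ t) (shift-bound d)) (≤-reflexive (swap-identity q (q ^ t) (suc (c + b)))))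

  top : Fin q → Grid → ℕ → A
  top d x β = f (γ d β mod Q) (argsOf x (γ d β / Q))

  entry : Fin q → Grid → ℕ → ℕ → A
  entry d x i β with i <? t
  ... | yes _ = cell x (suc i) (q ^ i * shift d + β)
  ... | no  _ = top d x β

  next : Grid → Fin q → Grid
  next x d = frame (entry d x)

  output : Grid → A
  output x = cell x 0 c

  window-step : ∀ n d → c + n₀ ≤ n → next (window n) d ≡ window (q * n + toℕ d)
  window-step n d n₁≤n = frame-cong _ _ λ i β i≤t β<w →
    trans (entry-ok i β i≤t β<w) (cong (λ k → U (q ^ i * k + β)) (sym (shift-step d c≤n)))
    where
    m : ℕ
    m = n ∸ c

    c≤n : c ≤ n
    c≤n = ≤-trans (m≤m+n c n₀) n₁≤n

    n₀≤m : n₀ ≤ m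
    n₀≤m = subst (_≤ m) (m+n∸m≡n c n₀) (∸-monoˡ-≤ c n₁≤n)

    top-ok : ∀ β → β < width t → top d (window n) β ≡ U (q ^ t * (q * m + shift d) + β)
    top-ok β β<w = begin
      f j (argsOf (window n) s)       ≡⟨ cong (f j) (args-window n s (top-lower d β) (top-upper d β<w)) ⟩
      f j (args q U t a b W (m + s))  ≡⟨ sym (U-rec j (m + s) (≤-trans n₀≤m (m≤m+n m s))) ⟩
      U (Q * (m + s) + toℕ j)         ≡⟨ cong U (sym (top-index m d β)) ⟩
      U (q ^ t * (q * m + shift d) + β) ∎
      where
      open ≡-Reasoning
      s : ℕ
      s = γ d β / Q
      j : Fin Q
      j = γ d β mod Q

    entry-ok : ∀ i β → i ≤ t → β < width i → entry d (window n) i β ≡ U (q ^ i * (q * m + shift d) + β)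
    entry-ok i β i≤t β<w with i <? t
    ... | yes i<t = trans (cell-frame _ i<t (level-bound {i} d β<w))
                          (cong U (sym (level-identity q (q ^ i) m (shift d) β)))
    ... | no  i≮t with ≤-antisym i≤t (≮⇒≥ i≮t)
    ...   | refl = top-ok β β<w

  window-output : ∀ n → c + n₀ ≤ n → output (window n) ≡ U n
  window-output n n₁≤n = trans (cell-window₀ n c<L) (cong U (m∸n+n≡m (≤-trans (m≤m+n c n₀) n₁≤n)))
    where
    c<L : c < L
    c<L = m<m+n c (s≤s z≤n)

theorem2 : {k : ℕ} (A : Set) → A ↔ Fin k →
           (q : ℕ) → 2 ≤ q → (U : ℕ → A) →
           (t a b n₀ : ℕ) →
           (f : Fin (q ^ suc t) → Vec A (a + (suc b + S q t)) → A) →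
           (W : Fin a → ℕ → A) →
           (∀ (i : Fin a) (n : ℕ) → a ∸ toℕ i ≤ n → W i n ≡ U (n ∸ (a ∸ toℕ i))) →
           (∀ (j : Fin (q ^ suc t)) (n : ℕ) → n₀ ≤ n →
             U (q ^ suc t * n + toℕ j) ≡ f j (args q U t a b W n)) →
           Automatic q U
theorem2 {k} A A↔Fin (suc (suc r)) 2≤q@(s≤s (s≤s z≤n)) U t a b n₀ f W W-shift U-rec =
  automatic-by-eventual-states q 2≤q U grids-finite next window output (c + n₀)
    window-step window-output
  where
  open WindowConstruction r U t a b n₀ f W W-shift U-rec
  grids-finite : Finite Grid
  grids-finite = finite-Vec (finite-Vec (k , A↔Fin) (width t)) (suc t)
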